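{- Let $\mathcal V$ be a constructively completely distributive unital commutative quantale and $T\colon\mathsf{Set}\to\mathsf{Set}$ a functor preserving weak pullbacks. Then for every function $f\colon X\to Y$ and every $p\colon X\to\mathcal V$, $\hat T_{can}(f_*(p))\le (Tf)_*(\hat T_{can}(p))$.
   Context: A unital commutative quantale $\mathcal V$ is a complete lattice $(\mathcal V,\le)$ with an associative, commutative operation $\otimes$ distributing over arbitrary joins $\bigvee$, with unit $1$. For $u,v\in\mathcal V$ write $u\lll v$ if for every $W\subseteq\mathcal V$ with $v\le\bigvee W$ there is $w\in W$ with $u\le w$; $\mathcal V$ is constructively completely distributive if $v=\bigvee\{u\mid u\lll v\}$ for all $v\in\mathcal V$. For $f\colon X\to Y$ and $p\colon X\to\mathcal V$, the direct image is $f_*(p)(y)=\bigvee\{p(x)\mid f(x)=y\}$. For $r\in\mathcal V$ let ${\uparrow}r=\{v\mid v\ge r\}$ with inclusion $\iota_r$; $u\in T({\uparrow}r)$ means $u$ is in the image of $T\iota_r$. The canonical lifting sends $p\colon X\to\mathcal V$ to $\hat T_{can}(p)(u)=\bigvee\{r\mid T(p)(u)\in T({\uparrow}r)\}$ for $u\in TX$. Inequalities between predicates are pointwise. -}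

module Defs where

open import Level using (Level; Setω; _⊔_) renaming (suc to lsuc; zero to lzero)
open import Data.Product using (Σ; _×_; _,_; proj₁)
open import Relation.Binary.PropositionalEquality using (_≡_)
open import Function using (id; _∘_)

record Quantale : Setω where
  infix 4 _≤_
  infixl 7 _⊗_
  field
    Carrier   : Set
    _≤_       : Carrier → Carrier → Set
    ≤-refl    : ∀ {a} → a ≤ a
    ≤-trans   : ∀ {a b c} → a ≤ b → b ≤ c → a ≤ c
    ≤-antisym : ∀ {a b} → a ≤ b → b ≤ a → a ≡ b
    ⋁         : ∀ {ℓ} → (Carrier → Set ℓ) → Carrier
    ⋁-upper   : ∀ {ℓ} (W : Carrier → Set ℓ) (v : Carrier) → W v → v ≤ ⋁ W
    ⋁-least   : ∀ {ℓ} (W : Carrier → Set ℓ) (u : Carrier) →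
                (∀ v → W v → v ≤ u) → ⋁ W ≤ u
    _⊗_       : Carrier → Carrier → Carrier
    𝟙         : Carrier
    ⊗-assoc   : ∀ a b c → (a ⊗ b) ⊗ c ≡ a ⊗ (b ⊗ c)
    ⊗-comm    : ∀ a b → a ⊗ b ≡ b ⊗ a
    ⊗-unitˡ   : ∀ a → 𝟙 ⊗ a ≡ a
    -- a ⊗ ⋁ W = ⋁ { a ⊗ w | w ∈ W }  (the other side follows by commutativity)
    ⊗-distrib-⋁ : ∀ {ℓ} (a : Carrier) (W : Carrier → Set ℓ) →
                  a ⊗ ⋁ W ≡ ⋁ (λ v → Σ Carrier (λ w → W w × (a ⊗ w ≡ v)))

module _ (V : Quantale) where
  open Quantale V

  _⋘_ : Carrier → Carrier → Set₁
  u ⋘ v = (W : Carrier → Set) → v ≤ ⋁ W → Σ Carrier (λ w → W w × (u ≤ w))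

  ConstructivelyCompletelyDistributive : Set
  ConstructivelyCompletelyDistributive =
    ∀ v → v ≡ ⋁ (λ u → u ⋘ v)

  -- ↑ r as a set, with its inclusion ι_r = proj₁
  ↑ : Carrier → Set
  ↑ r = Σ Carrier (λ v → r ≤ v)

  direct-image : {X Y : Set} → (X → Y) → (X → Carrier) → Y → Carrier
  direct-image {X} f p y = ⋁ (λ v → Σ X (λ x → (f x ≡ y) × (p x ≡ v)))

  _≤ₚ_ : {X : Set} → (X → Carrier) → (X → Carrier) → Set
  p ≤ₚ q = ∀ x → p x ≤ q x

record SetFunctor : Set₁ where
  field
    F      : Set → Set
    fmap   : {A B : Set} → (A → B) → F A → F B
    fmap-id : {A : Set} (x : F A) → fmap id x ≡ x
    fmap-∘  : {A B C : Set} (g : B → C) (f : A → B) (x : F A) →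
              fmap (g ∘ f) x ≡ fmap g (fmap f x)

IsWeakPullback : {P A B C : Set} (f : A → C) (g : B → C)
                 (p₁ : P → A) (p₂ : P → B) → Set
IsWeakPullback {P} {A} {B} f g p₁ p₂ =
  (∀ z → f (p₁ z) ≡ g (p₂ z)) ×
  (∀ a b → f a ≡ g b → Σ P (λ z → (p₁ z ≡ a) × (p₂ z ≡ b)))

module _ (T : SetFunctor) where
  open SetFunctor T

  PreservesWeakPullbacks : Set₁
  PreservesWeakPullbacks =
    {P A B C : Set} (f : A → C) (g : B → C) (p₁ : P → A) (p₂ : P → B) →
    IsWeakPullback f g p₁ p₂ →
    IsWeakPullback (fmap f) (fmap g) (fmap p₁) (fmap p₂)

-- canonical lifting:  T̂_can(p)(u) = ⋁ { r | T(p)(u) ∈ T(↑r) }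
-- where  T(p)(u) ∈ T(↑r)  means T(p)(u) is in the image of T(ι_r).
canonical-lifting : (V : Quantale) (T : SetFunctor) {X : Set} →
                    (X → Quantale.Carrier V) →
                    SetFunctor.F T X → Quantale.Carrier V
canonical-lifting V T p u =
  ⋁ (λ r → Σ (F (↑ V r)) (λ w → fmap proj₁ w ≡ fmap p u))
  where open Quantale V
        open SetFunctor T

-- If T(f_* p)(u) lies in T(↑r), pull it back along the weak pullback
-- {y | r ≤ f_* p(y)} of f_* p and ι_r to some z.  For s ⋘ r every such y has a
-- preimage x with s ≤ p x; choosing one gives σ, and Tσ(z) is a preimage of u
-- under Tf whose T p-image lies in T(↑s).  Hence every s ⋘ r is below the
-- right-hand side at u, and so is r by constructive complete distributivity.
module Submission where

open import Defs
open import Data.Product using (Σ; _×_; _,_; proj₁; proj₂)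
open import Relation.Binary.PropositionalEquality
  using (_≡_; refl; sym; trans; cong; subst; module ≡-Reasoning)
open import Function using (id; _∘_)

module QuantaleProperties (V : Quantale) where
  open Quantale V

  ≤-by-way-below : ConstructivelyCompletelyDistributive V → ∀ {r a} →
                   (∀ s → _⋘_ V s r → s ≤ a) → r ≤ a
  ≤-by-way-below ccd {r} {a} below = subst (_≤ a) (sym (ccd r)) (⋁-least _ a below)

  direct-image-upper : {X Y : Set} (f : X → Y) (p : X → Carrier) {x : X} {y : Y} →
                       f x ≡ y → p x ≤ direct-image V f p y
  direct-image-upper f p {x} fx≡y = ⋁-upper _ (p x) (x , fx≡y , refl)

  ⋘-direct-image⇒witness : {X Y : Set} (f : X → Y) (p : X → Carrier) {s r : Carrier} {y : Y} →
                           _⋘_ V s r → r ≤ direct-image V f p y →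
                           Σ X (λ x → (f x ≡ y) × (s ≤ p x))
  ⋘-direct-image⇒witness f p s⋘r r≤ with s⋘r _ r≤
  ... | _ , (x , fx≡y , refl) , s≤px = x , fx≡y , s≤px

module LiftingProperties (V : Quantale) (T : SetFunctor) where
  open Quantale V
  open SetFunctor T
  open QuantaleProperties V

  infix 4 _∈ᵀ↑_

  _∈ᵀ↑_ : F Carrier → Carrier → Set
  c ∈ᵀ↑ r = Σ (F (↑ V r)) (λ w → fmap proj₁ w ≡ c)

  canonical-lifting-upper : {X : Set} (p : X → Carrier) {u : F X} {r : Carrier} →
                            fmap p u ∈ᵀ↑ r → r ≤ canonical-lifting V T p u
  canonical-lifting-upper p {r = r} p[u]∈↑r = ⋁-upper _ r p[u]∈↑r

  fmap-bounded-below : {A : Set} (p : A → Carrier) {s : Carrier} →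
                       (∀ a → s ≤ p a) → ∀ z → fmap p z ∈ᵀ↑ s
  fmap-bounded-below p s≤p z = fmap (λ a → p a , s≤p a) z , sym (fmap-∘ proj₁ _ z)

  _⁻¹↑_ : {Y : Set} → (Y → Carrier) → Carrier → Set
  _⁻¹↑_ {Y} q r = Σ Y (λ y → r ≤ q y)

  ⁻¹↑-to-↑ : {Y : Set} (q : Y → Carrier) {r : Carrier} → q ⁻¹↑ r → ↑ V r
  ⁻¹↑-to-↑ q (y , r≤qy) = q y , r≤qy

  ⁻¹↑-isWeakPullback : {Y : Set} (q : Y → Carrier) (r : Carrier) →
                       IsWeakPullback q proj₁ proj₁ (⁻¹↑-to-↑ q {r})
  ⁻¹↑-isWeakPullback q r =
    (λ _ → refl) , λ { y (_ , r≤qy) refl → (y , r≤qy) , refl , refl }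

  module _ (pwp : PreservesWeakPullbacks T) where

    -- There is no function extensionality: the square with sides g, id, id, h
    -- is a weak pullback, and the image square under T commutes.
    fmap-cong : {A B : Set} (g h : A → B) → (∀ a → g a ≡ h a) →
                ∀ z → fmap g z ≡ fmap h z
    fmap-cong g h g≗h z = begin
      fmap g z               ≡⟨ cong (fmap g) (sym (fmap-id z)) ⟩
      fmap g (fmap id z)     ≡⟨ proj₁ (pwp g id id h square) z ⟩
      fmap id (fmap h z)     ≡⟨ fmap-id (fmap h z) ⟩
      fmap h z               ∎
      where
        open ≡-Reasoning
        square : IsWeakPullback g id id h
        square = g≗h , λ a b ga≡b → a , refl , trans (sym (g≗h a)) ga≡b

    ∈ᵀ↑⇒lifts-to-⁻¹↑ : {Y : Set} {q : Y → Carrier} {r : Carrier} {u : F Y} →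
                       fmap q u ∈ᵀ↑ r → Σ (F (q ⁻¹↑ r)) (λ z → fmap proj₁ z ≡ u)
    ∈ᵀ↑⇒lifts-to-⁻¹↑ {q = q} {r} {u} (w , ι[w]≡q[u])
      with proj₂ (pwp _ _ _ _ (⁻¹↑-isWeakPullback q r)) u w (sym ι[w]≡q[u])
    ... | z , π[z]≡u , _ = z , π[z]≡u

    way-below-≤-direct-image-lifting :
      {X Y : Set} (f : X → Y) (p : X → Carrier) {u : F Y} {r s : Carrier} →
      fmap (direct-image V f p) u ∈ᵀ↑ r → _⋘_ V s r →
      s ≤ direct-image V (fmap f) (canonical-lifting V T p) u
    way-below-≤-direct-image-lifting {X} f p {u} {r} {s} q[u]∈↑r s⋘r =
      ≤-trans (canonical-lifting-upper p p[u′]∈↑s) (direct-image-upper (fmap f) _ f[u′]≡u)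
      where
        open ≡-Reasoning
        q = direct-image V f p

        witness : (y : q ⁻¹↑ r) → Σ X (λ x → (f x ≡ proj₁ y) × (s ≤ p x))
        witness (_ , r≤qy) = ⋘-direct-image⇒witness f p s⋘r r≤qy

        σ : q ⁻¹↑ r → X
        σ = proj₁ ∘ witness

        lift = ∈ᵀ↑⇒lifts-to-⁻¹↑ q[u]∈↑r
        z = proj₁ lift

        u′ : F X
        u′ = fmap σ z

        f[u′]≡u : fmap f u′ ≡ u
        f[u′]≡u = begin
          fmap f (fmap σ z)  ≡⟨ sym (fmap-∘ f σ z) ⟩
          fmap (f ∘ σ) z     ≡⟨ fmap-cong (f ∘ σ) proj₁ (proj₁ ∘ proj₂ ∘ witness) z ⟩
          fmap proj₁ z       ≡⟨ proj₂ lift ⟩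
          u                  ∎

        p[u′]∈↑s : fmap p u′ ∈ᵀ↑ s
        p[u′]∈↑s = subst (_∈ᵀ↑ s) (fmap-∘ p σ z)
                     (fmap-bounded-below (p ∘ σ) (proj₂ ∘ proj₂ ∘ witness) z)

open QuantaleProperties using (≤-by-way-below)
open LiftingProperties using (way-below-≤-direct-image-lifting)

proposition29 : (V : Quantale) → ConstructivelyCompletelyDistributive V →
    (T : SetFunctor) → PreservesWeakPullbacks T →
    {X Y : Set} (f : X → Y) (p : X → Quantale.Carrier V) →
    _≤ₚ_ V (canonical-lifting V T (direct-image V f p))
           (direct-image V (SetFunctor.fmap T f) (canonical-lifting V T p))
proposition29 V ccd T pwp f p u =
  Quantale.⋁-least V _ _ λ r q[u]∈↑r →
    ≤-by-way-below V ccd λ s s⋘r →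
      way-below-≤-direct-image-lifting V T pwp f p q[u]∈↑r s⋘r
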